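{- Let $k \geq 2$ be an integer. Then the disjoint union $K_{1,(k-1)(k^3-k+2)} + K_{1,k^3}$ is not equitably $k$-choosable.
   Context: A list assignment $L$ for a graph $G$ assigns to each vertex $v$ a set $L(v)$ of colors; it is a $k$-assignment if $|L(v)|=k$ for all $v$. The palette of $L$ is $\bigcup_{v} L(v)$. A proper $L$-coloring is a proper coloring $f$ with $f(v)\in L(v)$ for all $v$. If $L$ is a $k$-assignment, an equitable $L$-coloring of $G$ is a proper $L$-coloring in which each color of the palette appears on at most $\lceil |V(G)|/k \rceil$ vertices. $G$ is equitably $k$-choosable if an equitable $L$-coloring exists for every $k$-assignment $L$ for $G$. -}

module Defs where

open import Data.Nat using (ℕ; zero; suc; _+_; _*_; _≤_)
open import Data.Nat.DivMod using (_/_)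
open import Data.Nat.Properties using (_≟_)
open import Data.Fin using (Fin; zero; suc; splitAt)
open import Data.Sum using (_⊎_; inj₁; inj₂)
open import Data.Product using (Σ; ∃; _×_; _,_)
open import Data.Empty using (⊥)
open import Data.Unit using (⊤)
open import Data.List using (List; length; filter; allFin)
open import Data.List.Membership.Propositional using (_∈_)
open import Data.List.Relation.Unary.Unique.Propositional using (Unique)
open import Relation.Nullary using (¬_)
open import Relation.Binary.PropositionalEquality using (_≡_)

record Graph (n : ℕ) : Set₁ where
  field
    Adj     : Fin n → Fin n → Set
    sym     : ∀ {u v} → Adj u v → Adj v u
    irrefl  : ∀ {v} → ¬ Adj v v
open Graph public

starAdj : ∀ {m} → Fin (suc m) → Fin (suc m) → Set
starAdj zero    zero    = ⊥
starAdj zero    (suc _) = ⊤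
starAdj (suc _) zero    = ⊤
starAdj (suc _) (suc _) = ⊥

star : (m : ℕ) → Graph (suc m)
star m = record { Adj = starAdj ; sym = s ; irrefl = i }
  where
  s : ∀ {u v} → starAdj {m} u v → starAdj v u
  s {zero}  {suc _} p = p
  s {suc _} {zero}  p = p
  i : ∀ {v} → ¬ starAdj {m} v v
  i {zero}  ()
  i {suc _} ()

unionAdj : ∀ {m n} → Graph m → Graph n → Fin m ⊎ Fin n → Fin m ⊎ Fin n → Set
unionAdj G H (inj₁ u) (inj₁ v) = Adj G u v
unionAdj G H (inj₂ u) (inj₂ v) = Adj H u v
unionAdj G H (inj₁ _) (inj₂ _) = ⊥
unionAdj G H (inj₂ _) (inj₁ _) = ⊥

_⊕_ : ∀ {m n} → Graph m → Graph n → Graph (m + n)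
_⊕_ {m} {n} G H = record
  { Adj = λ u v → unionAdj G H (splitAt m u) (splitAt m v)
  ; sym = λ {u} {v} → s (splitAt m u) (splitAt m v)
  ; irrefl = λ {v} → i (splitAt m v)
  }
  where
  s : ∀ a b → unionAdj G H a b → unionAdj G H b a
  s (inj₁ a) (inj₁ b) p = sym G p
  s (inj₂ a) (inj₂ b) p = sym H p
  i : ∀ a → ¬ unionAdj G H a a
  i (inj₁ a) = irrefl G
  i (inj₂ a) = irrefl H

ListAssignment : ℕ → Set
ListAssignment n = Fin n → List ℕ

IsKAssignment : ∀ {n} → ℕ → ListAssignment n → Set
IsKAssignment {n} k L = (v : Fin n) → Unique (L v) × length (L v) ≡ k

InPalette : ∀ {n} → ListAssignment n → ℕ → Set
InPalette {n} L c = ∃ λ (v : Fin n) → c ∈ L v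

IsProperLColoring : ∀ {n} → Graph n → ListAssignment n → (Fin n → ℕ) → Set
IsProperLColoring {n} G L f =
  ((v : Fin n) → f v ∈ L v) × (∀ u v → Adj G u v → ¬ f u ≡ f v)

colourCount : ∀ {n} → (Fin n → ℕ) → ℕ → ℕ
colourCount {n} f c = length (filter (λ v → f v ≟ c) (allFin n))

-- ceiling division ⌈ n / k ⌉ (value for k = 0 is irrelevant; set to 0)
⌈_/_⌉ : ℕ → ℕ → ℕ
⌈ n / zero ⌉  = 0
⌈ n / suc k ⌉ = (n + k) / suc k

IsEquitableLColoring : ∀ {n} → ℕ → Graph n → ListAssignment n → (Fin n → ℕ) → Set
IsEquitableLColoring {n} k G L f =
  IsProperLColoring G L f ×
  (∀ c → InPalette L c → colourCount f c ≤ ⌈ n / k ⌉)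

EquitablyChoosable : ∀ {n} → ℕ → Graph n → Set
EquitablyChoosable {n} k G =
  (L : ListAssignment n) → IsKAssignment k L →
  ∃ λ (f : Fin n → ℕ) → IsEquitableLColoring k G L f

module Submission where

-- Write k = j + 2, let m = (k-1)(k³-k+2) be the number of leaves of
-- the first star and N = (m+1) + (k³+1) the number of vertices, so ⌈N/k⌉ = k³-k+3.
-- Offer every vertex of the first star the low colours {0,…,k-1}, offer the centre
-- of the second star the high colours {k,…,2k-1}, and for every high colour k+d and
-- low colour c offer k leaves of the second star the list {k+d} ∪ ({0,…,k-1} ∖ {c}).
-- Given a proper colouring, let c be the colour of the first centre and k+d that of
-- the second.  Then the m leaves of the first star and the k leaves of the second
-- star labelled (d,c) all receive colours from the k-1 colours {0,…,k-1} ∖ {c}.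
-- Equitability allows each colour at most ⌈N/k⌉ times, but (k-1)⌈N/k⌉ = m+k-1 < m+k.

open import Defs hiding (sym)
open import Data.Nat using (ℕ; zero; suc; _+_; _*_; _∸_; _^_; _≤_; _<_; z≤n; s≤s; s≤s⁻¹)
open import Data.Nat.Properties
  using (_≟_; n≤1+n; ≤-refl; ≤-trans; ≤-reflexive; +-suc; +-mono-≤; +-monoˡ-≤; +-monoʳ-≤; +-monoʳ-<;
         *-monoʳ-≤; *-identityʳ; +-cancelˡ-≡; <⇒≱; m≤m+n; m≤m*n; m∸n+n≡m; module ≤-Reasoning)
open import Data.Nat.DivMod using (m<n*o⇒m/o<n)
open import Data.Nat.Tactic.RingSolver using (solve-∀)
open import Data.Fin using (Fin; zero; suc; toℕ; splitAt; join; punchIn; punchOut; combine; remQuot)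
open import Data.Fin.Properties
  using (injective⇒≤; toℕ<n; toℕ-injective; splitAt-join; join-splitAt; punchIn-punchOut;
         punchIn-injective; remQuot-combine; combine-injectiveʳ; suc-injective)
open import Data.List using (List; []; _∷_; length; filter; allFin; map; lookup)
open import Data.List.Properties using (length-map; length-tabulate; filter-accept; filter-none)
open import Data.List.Membership.Propositional using (_∈_)
open import Data.List.Membership.Propositional.Properties using (∈-filter⁺; ∈-allFin; ∈-map⁺; ∈-map⁻)
open import Data.List.Membership.DecPropositional _≟_ using (_∈?_)
open import Data.List.Relation.Unary.Any using (here; there; index)
open import Data.List.Relation.Unary.Any.Properties using (lookup-index)
open import Data.List.Relation.Unary.All as All using (All)
open import Data.List.Relation.Unary.AllPairs using (_∷_)
open import Data.List.Relation.Unary.Unique.Propositional using (Unique)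
import Data.List.Relation.Unary.Unique.Propositional.Properties as Unique
open import Data.Sum using (_⊎_; inj₁; inj₂)
open import Data.Sum.Properties using (inj₂-injective)
open import Data.Product using (_×_; _,_; proj₁; proj₂)
open import Data.Empty using (⊥-elim)
open import Data.Unit using (tt)
open import Data.Bool using (true; false)
open import Function using (_∘_)
open import Function.Definitions using (Injective)
open import Level using (0ℓ)
open import Relation.Nullary using (¬_; yes; no; does)
open import Relation.Unary using (Pred; Decidable)
open import Relation.Binary.PropositionalEquality
  using (_≡_; _≢_; refl; sym; trans; cong; subst; subst₂; module ≡-Reasoning)

module _ {A : Set} where

  filter-length-∷ : {P : Pred A 0ℓ} (P? : Decidable P) (x : A) (xs : List A) →
    length (filter P? xs) ≤ length (filter P? (x ∷ xs))
  filter-length-∷ P? x xs with does (P? x)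
  ... | true  = n≤1+n _
  ... | false = ≤-refl

  filter-length-∪ : {S P R : Pred A 0ℓ} (S? : Decidable S) (P? : Decidable P) (R? : Decidable R) →
    (∀ {x} → S x → P x ⊎ R x) → ∀ xs →
    length (filter S? xs) ≤ length (filter P? xs) + length (filter R? xs)
  filter-length-∪ S? P? R? S⊆P∪R [] = z≤n
  filter-length-∪ S? P? R? S⊆P∪R (x ∷ xs) with S? x
  ... | no _ = ≤-trans (filter-length-∪ S? P? R? S⊆P∪R xs)
                       (+-mono-≤ (filter-length-∷ P? x xs) (filter-length-∷ R? x xs))
  ... | yes s with S⊆P∪R s
  ...   | inj₁ p rewrite filter-accept P? {xs = xs} p =
            s≤s (≤-trans (filter-length-∪ S? P? R? S⊆P∪R xs) (+-monoʳ-≤ _ (filter-length-∷ R? x xs)))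
  ...   | inj₂ r rewrite filter-accept R? {xs = xs} r | +-suc (length (filter P? (x ∷ xs))) (length (filter R? xs)) =
            s≤s (≤-trans (filter-length-∪ S? P? R? S⊆P∪R xs) (+-monoˡ-≤ _ (filter-length-∷ P? x xs)))

colour-class-bound : {A : Set} (f : A → ℕ) (xs : List A) (B : ℕ) (C : List ℕ) →
  (∀ c → c ∈ C → length (filter (λ x → f x ≟ c) xs) ≤ B) →
  length (filter (λ x → f x ∈? C) xs) ≤ length C * B
colour-class-bound f xs B [] _ =
  ≤-reflexive (cong length (filter-none (λ x → f x ∈? []) (All.universal (λ _ ()) xs)))
colour-class-bound f xs B (c ∷ C) bounded = begin
  length (filter (λ x → f x ∈? (c ∷ C)) xs)
    ≤⟨ filter-length-∪ (λ x → f x ∈? (c ∷ C)) (λ x → f x ≟ c) (λ x → f x ∈? C) here-or-there xs ⟩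
  length (filter (λ x → f x ≟ c) xs) + length (filter (λ x → f x ∈? C) xs)
    ≤⟨ +-mono-≤ (bounded c (here refl)) (colour-class-bound f xs B C (λ c′ c′∈C → bounded c′ (there c′∈C))) ⟩
  B + length C * B ∎
  where
  open ≤-Reasoning
  here-or-there : ∀ {y} → y ∈ c ∷ C → y ≡ c ⊎ y ∈ C
  here-or-there (here y≡c)  = inj₁ y≡c
  here-or-there (there y∈C) = inj₂ y∈C

injection-count : ∀ {p N} {P : Pred (Fin N) 0ℓ} (P? : Decidable P) (g : Fin p → Fin N) →
  Injective _≡_ _≡_ g → (∀ i → P (g i)) → p ≤ length (filter P? (allFin N))
injection-count {p} {N} P? g g-inj g∈P = injective⇒≤ {f = position} position-injective
  where
  selected : List (Fin N)
  selected = filter P? (allFin N)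
  g∈selected : ∀ i → g i ∈ selected
  g∈selected i = ∈-filter⁺ P? (∈-allFin (g i)) (g∈P i)
  position : Fin p → Fin (length selected)
  position i = index (g∈selected i)
  position-injective : Injective _≡_ _≡_ position
  position-injective {i} {i′} same = g-inj (begin
    g i                          ≡⟨ lookup-index (g∈selected i) ⟩
    lookup selected (position i)  ≡⟨ cong (lookup selected) same ⟩
    lookup selected (position i′) ≡⟨ lookup-index (g∈selected i′) ⟨
    g i′                          ∎)
    where open ≡-Reasoning

distinct-image : ∀ {n} (g : Fin n → ℕ) → Injective _≡_ _≡_ g →
  Unique (map g (allFin n)) × length (map g (allFin n)) ≡ n
distinct-image {n} g g-inj =
  Unique.map⁺ g-inj (Unique.allFin⁺ n) ,
  trans (length-map g (allFin n)) (length-tabulate {n = n} (λ i → i))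

∈-tail : ∀ {x y} {ys : List ℕ} → x ∈ y ∷ ys → x ≢ y → x ∈ ys
∈-tail (here x≡y)  x≢y = ⊥-elim (x≢y x≡y)
∈-tail (there x∈ys) _  = x∈ys

module Counterexample (j : ℕ) where

  k : ℕ
  k = suc (suc j)

  m : ℕ
  m = (k ∸ 1) * ((k ^ 3 ∸ k) + 2)
  N : ℕ
  N = suc m + suc (k ^ 3)
  G : Graph N
  G = star m ⊕ star (k ^ 3)

  low : List ℕ
  low = map toℕ (allFin k)
  high : List ℕ
  high = map (λ d → k + toℕ d) (allFin k)
  lowWithout : Fin k → List ℕ
  lowWithout c = map (λ i → toℕ (punchIn c i)) (allFin (k ∸ 1))

  lowWithout⊆low : ∀ c {y} → y ∈ lowWithout c → y ∈ low
  lowWithout⊆low c y∈ with ∈-map⁻ _ y∈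
  ... | i , _ , refl = ∈-map⁺ toℕ (∈-allFin (punchIn c i))

  lowWithout-distinct : ∀ c → Unique (lowWithout c) × length (lowWithout c) ≡ k ∸ 1
  lowWithout-distinct c = distinct-image (λ i → toℕ (punchIn c i)) (punchIn-injective c _ _ ∘ toℕ-injective)

  ∈-lowWithout : ∀ c {y} → y ∈ low → y ≢ toℕ c → y ∈ lowWithout c
  ∈-lowWithout c y∈low y≢c with ∈-map⁻ toℕ y∈low
  ... | i , _ , refl = subst (λ z → toℕ z ∈ lowWithout c) (punchIn-punchOut c≢i)
                             (∈-map⁺ (λ i → toℕ (punchIn c i)) (∈-allFin (punchOut c≢i)))
    where
    c≢i : c ≢ i
    c≢i c≡i = y≢c (cong toℕ (sym c≡i))

  -- Leaves of the second star are indexed by triples (d, c, r) ∈ Fin k × Fin k × Fin k;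
  -- leaf (d, c, r) is offered the high colour k+d and the low colours other than c.
  -- (Fin (k * 1) is how Fin k appears in k³ = k * (k * (k * 1)).)
  leaf : Fin k → Fin k → Fin (k * 1) → Fin (k ^ 3)
  leaf d c r = combine d (combine c r)

  offeredTo : Fin k × Fin (k * (k * 1)) → List ℕ
  offeredTo (d , cr) = (k + toℕ d) ∷ lowWithout (proj₁ (remQuot {k} (k * 1) cr))

  leafList : Fin (k ^ 3) → List ℕ
  leafList l = offeredTo (remQuot {k} (k * (k * 1)) l)

  leafList-leaf : ∀ d c r → leafList (leaf d c r) ≡ (k + toℕ d) ∷ lowWithout c
  leafList-leaf d c r = begin
    offeredTo (remQuot {k} (k * (k * 1)) (combine d (combine c r)))
      ≡⟨ cong offeredTo (remQuot-combine d (combine c r)) ⟩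
    (k + toℕ d) ∷ lowWithout (proj₁ (remQuot {k} (k * 1) (combine c r)))
      ≡⟨ cong (λ cr → (k + toℕ d) ∷ lowWithout (proj₁ cr)) (remQuot-combine c r) ⟩
    (k + toℕ d) ∷ lowWithout c ∎
    where open ≡-Reasoning

  lists : Fin (suc m) ⊎ Fin (suc (k ^ 3)) → List ℕ
  lists (inj₁ _)       = low
  lists (inj₂ zero)    = high
  lists (inj₂ (suc l)) = leafList l

  L : ListAssignment N
  L x = lists (splitAt (suc m) x)

  lists-size : ∀ s → Unique (lists s) × length (lists s) ≡ k
  lists-size (inj₁ _)       = distinct-image toℕ toℕ-injective
  lists-size (inj₂ zero)    = distinct-image (λ d → k + toℕ d) (toℕ-injective ∘ +-cancelˡ-≡ k _ _)
  lists-size (inj₂ (suc l)) = offered-size (remQuot {k} (k * (k * 1)) l)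
    where
    offered-size : ∀ dcr → Unique (offeredTo dcr) × length (offeredTo dcr) ≡ k
    offered-size (d , cr) = (All.tabulate high∉low ∷ proj₁ (lowWithout-distinct c)) ,
                            cong suc (proj₂ (lowWithout-distinct c))
      where
      c : Fin k
      c = proj₁ (remQuot {k} (k * 1) cr)
      high∉low : ∀ {y} → y ∈ lowWithout c → k + toℕ d ≢ y
      high∉low y∈ high≡y with ∈-map⁻ toℕ (lowWithout⊆low c y∈)
      ... | i , _ , refl = <⇒≱ (toℕ<n i) (≤-trans (m≤m+n k (toℕ d)) (≤-reflexive high≡y))

  L-is-k-assignment : IsKAssignment k L
  L-is-k-assignment x = lists-size (splitAt (suc m) x)

  vertex : Fin (suc m) ⊎ Fin (suc (k ^ 3)) → Fin N
  vertex = join (suc m) (suc (k ^ 3))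

  vertex-injective : Injective _≡_ _≡_ vertex
  vertex-injective {s} {t} same = begin
    s                           ≡⟨ splitAt-join (suc m) (suc (k ^ 3)) s ⟨
    splitAt (suc m) (vertex s)  ≡⟨ cong (splitAt (suc m)) same ⟩
    splitAt (suc m) (vertex t)  ≡⟨ splitAt-join (suc m) (suc (k ^ 3)) t ⟩
    t                           ∎
    where open ≡-Reasoning

  vertex-list : ∀ s → L (vertex s) ≡ lists s
  vertex-list s = cong lists (splitAt-join (suc m) (suc (k ^ 3)) s)

  vertex-adj : ∀ {s t} → unionAdj (star m) (star (k ^ 3)) s t → Adj G (vertex s) (vertex t)
  vertex-adj {s} {t} = subst₂ (unionAdj (star m) (star (k ^ 3)))
    (sym (splitAt-join (suc m) (suc (k ^ 3)) s)) (sym (splitAt-join (suc m) (suc (k ^ 3)) t))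

  -- ⌈N/k⌉ = k³-k+3, so k-1 colours used at most ⌈N/k⌉ times each cover fewer than m+k vertices.
  equitable-room : (k ∸ 1) * ⌈ N / k ⌉ < m + k * 1
  equitable-room = begin-strict
    suc j * ⌈ N / k ⌉  ≤⟨ *-monoʳ-≤ (suc j) (s≤s⁻¹ ceiling-bound) ⟩
    suc j * (e + 3)    ≡⟨ expand j e ⟩
    m + suc j          <⟨ +-monoʳ-< m (≤-reflexive (sym (*-identityʳ k))) ⟩
    m + k * 1          ∎
    where
    open ≤-Reasoning
    e : ℕ
    e = k ^ 3 ∸ k
    -- N = (m+1) + (e+k+1), using k ≤ k³.
    vertex-count : N ≡ suc (suc j * (e + 2)) + suc (e + k)
    vertex-count = cong (λ t → suc m + suc t) (sym (m∸n+n≡m (m≤m*n k (k * (k * 1)))))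
    -- N + (k-1) + 1 = (e+4)·k, hence ⌈N/k⌉ < e+4.
    round-up : ∀ j e → suc (suc (suc j * (e + 2)) + suc (e + suc (suc j)) + suc j) ≡ suc (e + 3) * suc (suc j)
    round-up = solve-∀
    expand : ∀ j e → suc j * (e + 3) ≡ suc j * (e + 2) + suc j
    expand = solve-∀
    ceiling-bound : ⌈ N / k ⌉ < suc (e + 3)
    ceiling-bound = m<n*o⇒m/o<n {N + suc j} {suc (e + 3)} {k}
      (≤-reflexive (trans (cong (λ n → suc (n + suc j)) vertex-count) (round-up j e)))

  module Crowded (f : Fin N → ℕ) (proper : IsProperLColoring G L f) where

    coloured-from-list : ∀ s → f (vertex s) ∈ lists s
    coloured-from-list s = subst (f (vertex s) ∈_) (vertex-list s) (proj₁ proper (vertex s))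

    no-clash : ∀ {s t} → unionAdj (star m) (star (k ^ 3)) s t → f (vertex s) ≢ f (vertex t)
    no-clash {s} {t} adjacent = proj₂ proper (vertex s) (vertex t) (vertex-adj {s} {t} adjacent)

    c : Fin k
    c = proj₁ (∈-map⁻ toℕ (coloured-from-list (inj₁ zero)))
    centre₁-colour : f (vertex (inj₁ zero)) ≡ toℕ c
    centre₁-colour = proj₂ (proj₂ (∈-map⁻ toℕ (coloured-from-list (inj₁ zero))))

    d : Fin k
    d = proj₁ (∈-map⁻ (λ d → k + toℕ d) (coloured-from-list (inj₂ zero)))
    centre₂-colour : f (vertex (inj₂ zero)) ≡ k + toℕ d
    centre₂-colour = proj₂ (proj₂ (∈-map⁻ (λ d → k + toℕ d) (coloured-from-list (inj₂ zero))))

    crowded : Fin m ⊎ Fin (k * 1) → Fin (suc m) ⊎ Fin (suc (k ^ 3))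
    crowded (inj₁ i) = inj₁ (suc i)
    crowded (inj₂ r) = inj₂ (suc (leaf d c r))

    crowded-injective : Injective _≡_ _≡_ crowded
    crowded-injective {inj₁ i} {inj₁ i′} refl = refl
    crowded-injective {inj₁ i} {inj₂ r′} ()
    crowded-injective {inj₂ r} {inj₁ i′} ()
    crowded-injective {inj₂ r} {inj₂ r′} same = cong inj₂
      (combine-injectiveʳ c r c r′ (combine-injectiveʳ d _ d _ (suc-injective (inj₂-injective same))))

    -- A first-star leaf avoids the colour c of its centre; leaf (d, c, r) avoids k+d.
    crowded-colour : ∀ s → f (vertex (crowded s)) ∈ lowWithout c
    crowded-colour (inj₁ i) = ∈-lowWithout c (coloured-from-list (inj₁ (suc i)))
      (λ same → no-clash {inj₁ zero} {inj₁ (suc i)} tt (trans centre₁-colour (sym same)))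
    crowded-colour (inj₂ r) = ∈-tail
      (subst (f (vertex (crowded (inj₂ r))) ∈_) (leafList-leaf d c r) (coloured-from-list (crowded (inj₂ r))))
      (λ same → no-clash {inj₂ zero} {crowded (inj₂ r)} tt (trans centre₂-colour (sym same)))

    crowded-count : m + k * 1 ≤ length (filter (λ x → f x ∈? lowWithout c) (allFin N))
    crowded-count = injection-count (λ x → f x ∈? lowWithout c) (vertex ∘ crowded ∘ splitAt m)
      (splitAt-injective ∘ crowded-injective ∘ vertex-injective) (crowded-colour ∘ splitAt m)
      where
      splitAt-injective : Injective _≡_ _≡_ (splitAt m {k * 1})
      splitAt-injective {y} {y′} same = begin
        y                          ≡⟨ join-splitAt m (k * 1) y ⟨
        join m (k * 1) (splitAt m y)  ≡⟨ cong (join m (k * 1)) same ⟩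
        join m (k * 1) (splitAt m y′) ≡⟨ join-splitAt m (k * 1) y′ ⟩
        y′                         ∎
        where open ≡-Reasoning

  not-equitable : ∀ f → ¬ IsEquitableLColoring k G L f
  not-equitable f (proper , balanced) = <⇒≱ equitable-room (begin
    m + k * 1
      ≤⟨ crowded-count ⟩
    length (filter (λ x → f x ∈? lowWithout c) (allFin N))
      ≤⟨ colour-class-bound f (allFin N) ⌈ N / k ⌉ (lowWithout c)
           (λ c′ c′∈ → balanced c′ (vertex (inj₁ zero) , lowWithout⊆low c c′∈)) ⟩
    length (lowWithout c) * ⌈ N / k ⌉
      ≡⟨ cong (_* ⌈ N / k ⌉) (proj₂ (lowWithout-distinct c)) ⟩
    (k ∸ 1) * ⌈ N / k ⌉ ∎)
    where
    open Crowded f proper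
    open ≤-Reasoning

  not-equitably-choosable : ¬ EquitablyChoosable k G
  not-equitably-choosable choosable with choosable L L-is-k-assignment
  ... | f , equitable = not-equitable f equitable

proposition4p6 : (k : ℕ) → 2 ≤ k →
    ¬ EquitablyChoosable k (star ((k ∸ 1) * ((k ^ 3 ∸ k) + 2)) ⊕ star (k ^ 3))
proposition4p6 (suc (suc j)) _         = Counterexample.not-equitably-choosable j
proposition4p6 (suc zero)    (s≤s ())
proposition4p6 zero          ()
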